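{- For every $t\in\mathbb{N}$, if a partial half-graph $H$ with sides $L,R$ contains a matching of size $2t-1$, then $H$ contains a biclique $K_{t,t}$ as a subgraph.
   Context: The half-graph $H_k$ has vertices $v_1,\dots,v_k,w_1,\dots,w_k$ with $v_iw_j$ an edge iff $i\le j$. A bipartite graph with sides $L,R$ is a partial half-graph if for some $k$ there are injections $\alpha:L\to\{v_1,\dots,v_k\}$ and $\beta:R\to\{w_1,\dots,w_k\}$ such that $ab$ is an edge iff $\alpha(a)\beta(b)$ is an edge of $H_k$. $K_{t,t}$ is the complete bipartite graph with $t$ vertices on each side. -}

module Defs where

open import Data.Nat using (ℕ; _≤_; _*_; _∸_)
open import Data.Fin using (Fin; toℕ)
open import Data.Product using (Σ; _×_; ∃)
open import Function.Definitions using (Injective)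
open import Relation.Binary.PropositionalEquality using (_≡_)
open import Function.Bundles using (_⇔_)
open import Level using (0ℓ; suc)

record BipGraph (m n : ℕ) : Set₁ where
  field
    Edge : Fin m → Fin n → Set
open BipGraph public

-- Edge relation of the half-graph H_k: v_i w_j is an edge iff i ≤ j
-- (indices 0-based, which is an order-isomorphic relabelling).
HalfEdge : {k : ℕ} → Fin k → Fin k → Set
HalfEdge i j = toℕ i ≤ toℕ j

IsPartialHalfGraph : {m n : ℕ} → BipGraph m n → Set
IsPartialHalfGraph {m} {n} H =
  Σ ℕ λ k → Σ (Fin m → Fin k) λ α → Σ (Fin n → Fin k) λ β →
    Injective _≡_ _≡_ α × Injective _≡_ _≡_ β ×
    (∀ a b → Edge H a b ⇔ HalfEdge (α a) (β b))

HasMatching : {m n : ℕ} → BipGraph m n → ℕ → Set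
HasMatching {m} {n} H s =
  Σ (Fin s → Fin m) λ f → Σ (Fin s → Fin n) λ g →
    Injective _≡_ _≡_ f × Injective _≡_ _≡_ g × (∀ i → Edge H (f i) (g i))

HasBiclique : {m n : ℕ} → BipGraph m n → ℕ → Set
HasBiclique {m} {n} H t =
  Σ (Fin t → Fin m) λ A → Σ (Fin t → Fin n) λ B →
    Injective _≡_ _≡_ A × Injective _≡_ _≡_ B × (∀ i j → Edge H (A i) (B j))

{-# OPTIONS --safe #-}
module Submission where

-- Let x₁ ≤ y₁, …, x_s ≤ y_s be the positions (α, β) of the s = 2t − 1
-- matching edges in the half-graph, and let c be the t-th smallest xᵢ, i.e.
-- the point where #{i : xᵢ < c} crosses t. Then at least t edges have xᵢ ≤ c
-- and at least s − (t − 1) = t have c ≤ xⱼ. For any such i and j,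
-- α(fᵢ) = xᵢ ≤ c ≤ xⱼ ≤ yⱼ = β(gⱼ), so fᵢ gⱼ is an edge: these t left and
-- t right endpoints span a K_{t,t}.

open import Defs
open import Data.Nat using (ℕ; zero; suc; _+_; _*_; _∸_; _≤_; _<_; s≤s; s≤s⁻¹; z≤n)
open import Data.Nat.Properties
open import Data.Fin using (Fin; toℕ; inject≤) renaming (zero to fzero; suc to fsuc)
open import Data.Fin.Properties using (inject≤-injective)
open import Data.List using (List; []; _∷_; filter; length; lookup; allFin; tabulate)
open import Data.List.Extrema.Nat using (max; xs≤max)
open import Data.List.Properties using (length-tabulate; filter-all; filter-none; filter-≐)
open import Data.List.Membership.Propositional using (_∈_)
open import Data.List.Membership.Propositional.Properties using (∈-lookup; ∈-filter⁻)
open import Data.List.Relation.Unary.All as All using ()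
open import Data.List.Relation.Unary.All.Properties using (tabulate⁺; tabulate⁻)
open import Data.List.Relation.Unary.AllPairs using (_∷_)
open import Data.List.Relation.Unary.Unique.Propositional using (Unique)
open import Data.List.Relation.Unary.Unique.Propositional.Properties using (allFin⁺; filter⁺)
open import Data.Product using (Σ; ∃; _×_; _,_; proj₂)
open import Function using (_∘_)
open import Function.Bundles using (_⇔_; Equivalence)
open import Function.Construct.Composition using (injective)
open import Function.Definitions using (Injective)
open import Level using (Level)
open import Relation.Binary.PropositionalEquality using (_≡_; refl; sym; trans; cong; subst)
open import Relation.Nullary using (¬_; yes; no; contradiction)
open import Relation.Unary using (Pred; Decidable; _≐_)
open import Relation.Unary.Properties using (∁?)

private
  variable
    a ℓ : Level
    A : Set a

lookup-injective : {xs : List A} → Unique xs → Injective _≡_ _≡_ (lookup xs)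
lookup-injective (_  ∷ _)   {fzero}  {fzero}  _  = refl
lookup-injective (x∉ ∷ _)   {fzero}  {fsuc j} eq = contradiction eq (All.lookup x∉ (∈-lookup j))
lookup-injective (x∉ ∷ _)   {fsuc i} {fzero}  eq = contradiction (sym eq) (All.lookup x∉ (∈-lookup i))
lookup-injective (_  ∷ xs!) {fsuc i} {fsuc j} eq = cong fsuc (lookup-injective xs! eq)

distinct-members : {xs : List A} (t : ℕ) → Unique xs → t ≤ length xs →
                   Σ (Fin t → A) λ h → Injective _≡_ _≡_ h × (∀ i → h i ∈ xs)
distinct-members {xs = xs} t xs! t≤ =
  lookup xs ∘ (λ i → inject≤ i t≤) ,
  injective _≡_ _≡_ _≡_ (inject≤-injective t≤ t≤ _ _) (lookup-injective xs!) ,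
  λ i → ∈-lookup (inject≤ i t≤)

length-filter-∁ : {P : Pred A ℓ} (P? : Decidable P) (xs : List A) →
                  length (filter P? xs) + length (filter (∁? P?) xs) ≡ length xs
length-filter-∁ P? []       = refl
length-filter-∁ P? (x ∷ xs) with P? x
... | yes _ = cong suc (length-filter-∁ P? xs)
... | no  _ = trans (+-suc _ _) (cong suc (length-filter-∁ P? xs))

count : {s : ℕ} {P : Pred (Fin s) ℓ} → Decidable P → ℕ
count {s = s} P? = length (filter P? (allFin s))

module _ {s : ℕ} {P : Pred (Fin s) ℓ} (P? : Decidable P) where

  count-∁ : count P? + count (∁? P?) ≡ s
  count-∁ = trans (length-filter-∁ P? (allFin s)) (length-tabulate _)

  count-≐ : {Q : Pred (Fin s) ℓ} (Q? : Decidable Q) → P ≐ Q → count P? ≡ count Q?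
  count-≐ Q? P≐Q = cong length (filter-≐ P? Q? P≐Q (allFin s))

  count-all : (∀ i → P i) → count P? ≡ s
  count-all all = trans (cong length (filter-all P? (tabulate⁺ all))) (length-tabulate _)

  count-none : (∀ i → ¬ P i) → count P? ≡ 0
  count-none none = cong length (filter-none P? (tabulate⁺ none))

  choose : (t : ℕ) → t ≤ count P? → Σ (Fin t → Fin s) λ h → Injective _≡_ _≡_ h × (∀ i → P (h i))
  choose t t≤ =
    let h , h-inj , h∈ = distinct-members t (filter⁺ P? (allFin⁺ s)) t≤
    in  h , h-inj , proj₂ ∘ ∈-filter⁻ P? {xs = allFin s} ∘ h∈

threshold-crossing : (g : ℕ → ℕ) {t : ℕ} (K : ℕ) → g 0 < t → t ≤ g K →
                     ∃ λ c → g c < t × t ≤ g (suc c)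
threshold-crossing g zero    g0<t t≤gK = contradiction t≤gK (<⇒≱ g0<t)
threshold-crossing g {t} (suc K) g0<t t≤gK with t ≤? g K
... | yes t≤gK′ = threshold-crossing g K g0<t t≤gK′
... | no  t≰gK′ = K , ≰⇒> t≰gK′ , t≤gK

bounded : {s : ℕ} (x : Fin s → ℕ) → ∃ λ k → ∀ i → x i < k
bounded x = suc (max 0 (tabulate x)) , λ i → s≤s (tabulate⁻ (xs≤max 0 (tabulate x)) i)

order-statistic : {s : ℕ} (x : Fin s → ℕ) {p q : ℕ} → p + q < s →
                  ∃ λ c → p < count (λ i → x i ≤? c) × q < count (λ i → c ≤? x i)
order-statistic {s} x {p} {q} p+q<s =
  let k , x<k = bounded x
      c , below[c]<1+p , p<below[1+c] =
        threshold-crossing below k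
          (subst (_< suc p) (sym below[0]≡0) (s≤s z≤n))
          (subst (suc p ≤_) (sym (count-all (λ i → x i <? k) x<k)) (m+n≤o⇒m≤o (suc p) p+q<s))
  in c , p<atMost c p<below[1+c] , q<atLeast c (s≤s⁻¹ below[c]<1+p)
  where
  below : ℕ → ℕ
  below c = count (λ i → x i <? c)

  below[0]≡0 : below 0 ≡ 0
  below[0]≡0 = count-none (λ i → x i <? 0) (λ _ ())

  p<atMost : ∀ c → p < below (suc c) → p < count (λ i → x i ≤? c)
  p<atMost c p<below[1+c] =
    subst (p <_) (count-≐ (λ i → x i <? suc c) (λ i → x i ≤? c) (s≤s⁻¹ , s≤s)) p<below[1+c]

  q<atLeast : ∀ c → below c ≤ p → q < count (λ i → c ≤? x i)
  q<atLeast c below[c]≤p = +-cancelˡ-≤ p (suc q) _ (begin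
    p + suc q                    ≡⟨ +-suc p q ⟩
    suc (p + q)                  ≤⟨ p+q<s ⟩
    s                            ≡⟨ count-∁ x<?c ⟨
    below c + count (∁? x<?c)    ≤⟨ +-monoˡ-≤ _ below[c]≤p ⟩
    p + count (∁? x<?c)          ≡⟨ cong (p +_) (count-≐ (∁? x<?c) (λ i → c ≤? x i) (≮⇒≥ , ≤⇒≯)) ⟩
    p + count (λ i → c ≤? x i)   ∎)
    where
    open ≤-Reasoning
    x<?c : Decidable (λ i → x i < c)
    x<?c i = x i <? c

edge-antitoneˡ : {m n k : ℕ} (H : BipGraph m n) {α : Fin m → Fin k} {β : Fin n → Fin k} →
                 (∀ a b → Edge H a b ⇔ HalfEdge (α a) (β b)) →
                 ∀ {a a′ b} → toℕ (α a) ≤ toℕ (α a′) → Edge H a′ b → Edge H a b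
edge-antitoneˡ H E {a} {a′} {b} αa≤αa′ a′b =
  Equivalence.from (E a b) (≤-trans αa≤αa′ (Equivalence.to (E a′ b) a′b))

2*[1+n]∸1≡1+[n+n] : ∀ n → 2 * suc n ∸ 1 ≡ suc (n + n)
2*[1+n]∸1≡1+[n+n] n = trans (+-suc n (n + 0)) (cong (suc ∘ (n +_)) (+-identityʳ n))

lemma5p4 : (t : ℕ) {m n : ℕ} (H : BipGraph m n) →
    IsPartialHalfGraph H → HasMatching H (2 * t ∸ 1) → HasBiclique H t
lemma5p4 zero    H _ _ = (λ ()) , (λ ()) , (λ { {()} }) , (λ { {()} }) , λ ()
lemma5p4 (suc u) H (_ , α , _ , _ , _ , E) (f , g , f-inj , g-inj , matched) =
  let x : Fin (2 * suc u ∸ 1) → ℕ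
      x i = toℕ (α (f i))
      c , u<atMost , u<atLeast = order-statistic x (≤-reflexive (sym (2*[1+n]∸1≡1+[n+n] u)))
      low  , low-inj  , low≤c  = choose (λ i → x i ≤? c) (suc u) u<atMost
      high , high-inj , c≤high = choose (λ i → c ≤? x i) (suc u) u<atLeast
  in  f ∘ low , g ∘ high ,
      injective _≡_ _≡_ _≡_ low-inj f-inj , injective _≡_ _≡_ _≡_ high-inj g-inj ,
      λ i j → edge-antitoneˡ H E (≤-trans (low≤c i) (c≤high j)) (matched (high j))
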